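{- For every $n\ge 3$, the circular shift $\sigma:\{0,1\}^n\to\{0,1\}^n$, $\sigma(x_1,\dots,x_n)=(x_n,x_1,\dots,x_{n-1})$, has an even number of limit cycles.
   Context: For a bijection of $\{0,1\}^n$, the limit cycles are the cycles of the permutation (fixed points count as cycles of length $1$). -}

module Defs where

open import Data.Bool using (Bool; true; false; _∧_; _∨_; not)
open import Data.Nat using (ℕ; zero; suc; _^_)
open import Data.List using (List; []; _∷_; map; concatMap; length; filterᵇ; upTo)
open import Data.Bool.ListAction using (and)
open import Data.Vec using (Vec; []; _∷_; last; init)

allStates : (n : ℕ) → List (Vec Bool n)
allStates zero    = [] ∷ []
allStates (suc n) = concatMap (λ v → (false ∷ v) ∷ (true ∷ v) ∷ []) (allStates n)

shift : (n : ℕ) → Vec Bool n → Vec Bool n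
shift zero    []      = []
shift (suc n) (x ∷ xs) = last (x ∷ xs) ∷ init (x ∷ xs)

iter : {A : Set} → (A → A) → ℕ → A → A
iter f zero    x = x
iter f (suc k) x = f (iter f k x)

lexLeq : {n : ℕ} → Vec Bool n → Vec Bool n → Bool
lexLeq []       []       = true
lexLeq (false ∷ xs) (false ∷ ys) = lexLeq xs ys
lexLeq (true  ∷ xs) (true  ∷ ys) = lexLeq xs ys
lexLeq (false ∷ xs) (true  ∷ ys) = true
lexLeq (true  ∷ xs) (false ∷ ys) = false

-- For a bijection f of {0,1}^n, the orbit (= cycle) of x is {f^k x | k < 2^n}.
-- x is the canonical representative of its cycle iff it is lex-least in it.
isCycleRep : (n : ℕ) → (Vec Bool n → Vec Bool n) → Vec Bool n → Bool
isCycleRep n f x = and (map (λ k → lexLeq x (iter f k x)) (upTo (2 ^ n)))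

-- Number of limit cycles (cycles of the permutation, fixed points included):
-- one per cycle, counted via its lex-least element.
numLimitCycles : (n : ℕ) → (Vec Bool n → Vec Bool n) → ℕ
numLimitCycles n f = length (filterᵇ (isCycleRep n f) (allStates n))

-- Write σₙ for the shift on {0,1}ⁿ. On {0,1}^(m+2), σ is the map (b, x) ↦ (b, σ_(m+1) x) followed by
-- the exchange of the first two coordinates. The first map has exactly twice as many cycles as σ_(m+1):
-- one copy for each value of the fixed first bit. The exchange is the product of the 2^m transpositions
-- (0,1,w) ↔ (1,0,w), and composing a permutation with a transposition (a b) changes its number of cycles
-- by exactly one: a cycle through a and b splits into two, or the cycles of a and b merge. Hence for
-- m ≥ 1 the number of cycles of σ_(m+2) is even.

module Submission where

open import Defs
open import Data.Bool using (Bool; true; false; T; not; _∨_; _xor_; if_then_else_)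
open import Data.Bool.ListAction using (and)
import Data.Bool.Properties as Boolₚ
open import Data.Bool.Properties using (T-∨; ∨-identityʳ; not-involutive; not-distribˡ-xor)
open import Data.Empty using (⊥-elim)
open import Data.Fin using (Fin; toℕ; funToFin; finToFun)
open import Data.Fin.Properties using (2↔Bool; finToFun-funToFin; pigeonhole; toℕ<n)
open import Data.List using (List; []; _∷_; length; filterᵇ; concatMap; upTo; foldr)
open import Data.List.Properties using (map-cong)
open import Data.List.Relation.Unary.All.Properties using (all⁺; all⁻; applyUpTo⁺₁; applyUpTo⁻)
open import Data.Nat using (ℕ; zero; suc; _+_; _*_; _∸_; _^_; _≤_; _<_; z≤n; s≤s; z<s; NonZero; _≤?_; _<?_)
open import Data.Nat.DivMod using (_%_; _/_; m≡m%n+[m/n]*n; m%n<n)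
open import Data.Nat.Divisibility using (_∣_; divides; ∣-refl; ∣m∣n⇒∣m+n)
open import Data.Nat.Properties hiding (_≟_)
open import Data.Product using (∃; _×_; _,_; proj₁; proj₂)
open import Data.Sum as Sum using (_⊎_; inj₁; inj₂; [_,_])
open import Data.Sum.Function.Propositional using (_⊎-⇔_)
open import Data.Unit using (tt)
open import Data.Vec using (Vec; []; _∷_; lookup; tabulate; last; init)
open import Data.Vec.Properties using (tabulate∘lookup; tabulate-cong; ≡-dec; ∷-injectiveˡ; ∷-injectiveʳ)
open import Function using (_∘_; id; _⇔_; mk⇔; Equivalence; Inverse)
open import Function.Definitions using (Injective)
import Function.Properties.Equivalence as ⇔
open import Level using (0ℓ)
open import Relation.Binary.Definitions using (DecidableEquality; tri<; tri≈; tri>)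
open import Relation.Binary.PropositionalEquality hiding ([_])
open import Relation.Nullary using (¬_; Dec; yes; no; does; _×-dec_)
open import Relation.Nullary.Decidable using (dec-true; dec-false; map′)
open import Relation.Unary using (Pred; Decidable)

_≟_ : ∀ {n} → DecidableEquality (Vec Bool n)
_≟_ = ≡-dec Boolₚ._≟_

T-injective : ∀ {b c} → T b ⇔ T c → b ≡ c
T-injective {false} {false} _   = refl
T-injective {false} {true}  b⇔c = ⊥-elim (Equivalence.from b⇔c tt)
T-injective {true}  {false} b⇔c = ⊥-elim (Equivalence.to b⇔c tt)
T-injective {true}  {true}  _   = refl

T-does : ∀ {P : Set} (P? : Dec P) → T (does P?) ⇔ P
T-does (yes p) = mk⇔ (λ _ → p) (λ _ → tt)
T-does (no ¬p) = mk⇔ (λ ()) ¬p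

-- Lexicographic order

infix 4 _≼_

-- A record rather than T (lexLeq x y) itself, so that x and y can be inferred from a proof.
record _≼_ {n} (x y : Vec Bool n) : Set where
  constructor lex≤
  field holds : T (lexLeq x y)

∷-mono-≼ : ∀ {n} b {x y : Vec Bool n} → x ≼ y → b ∷ x ≼ b ∷ y
∷-mono-≼ false (lex≤ p) = lex≤ p
∷-mono-≼ true  (lex≤ p) = lex≤ p

∷-cancel-≼ : ∀ {n} b {x y : Vec Bool n} → b ∷ x ≼ b ∷ y → x ≼ y
∷-cancel-≼ false (lex≤ p) = lex≤ p
∷-cancel-≼ true  (lex≤ p) = lex≤ p

≼-refl : ∀ {n} (x : Vec Bool n) → x ≼ x
≼-refl []      = lex≤ tt
≼-refl (b ∷ x) = ∷-mono-≼ b (≼-refl x)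

≼-antisym : ∀ {n} {x y : Vec Bool n} → x ≼ y → y ≼ x → x ≡ y
≼-antisym {x = []}    {[]}    _ _ = refl
≼-antisym {x = false ∷ x} {true ∷ y}  _ (lex≤ ())
≼-antisym {x = true ∷ x}  {false ∷ y} (lex≤ ()) _
≼-antisym {x = false ∷ x} {false ∷ y} p q =
  cong (false ∷_) (≼-antisym (∷-cancel-≼ false p) (∷-cancel-≼ false q))
≼-antisym {x = true ∷ x}  {true ∷ y}  p q =
  cong (true ∷_) (≼-antisym (∷-cancel-≼ true p) (∷-cancel-≼ true q))

≼-trans : ∀ {n} {x y z : Vec Bool n} → x ≼ y → y ≼ z → x ≼ z
≼-trans {x = []}        {[]}        {[]}        _ _ = lex≤ tt
≼-trans {x = false ∷ x} {false ∷ y} {false ∷ z} p q =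
  ∷-mono-≼ false (≼-trans (∷-cancel-≼ false p) (∷-cancel-≼ false q))
≼-trans {x = true ∷ x}  {true ∷ y}  {true ∷ z}  p q =
  ∷-mono-≼ true (≼-trans (∷-cancel-≼ true p) (∷-cancel-≼ true q))
≼-trans {x = false ∷ x} {false ∷ y} {true ∷ z}  _ _ = lex≤ tt
≼-trans {x = false ∷ x} {true ∷ y}  {true ∷ z}  _ _ = lex≤ tt
≼-trans {x = false ∷ x} {true ∷ y}  {false ∷ z} _ (lex≤ ())
≼-trans {x = true ∷ x}  {false ∷ y}             (lex≤ ()) _
≼-trans {x = true ∷ x}  {true ∷ y}  {false ∷ z} _ (lex≤ ())

≼-total : ∀ {n} (x y : Vec Bool n) → x ≼ y ⊎ y ≼ x
≼-total []          []          = inj₁ (lex≤ tt)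
≼-total (false ∷ x) (true ∷ y)  = inj₁ (lex≤ tt)
≼-total (true ∷ x)  (false ∷ y) = inj₂ (lex≤ tt)
≼-total (false ∷ x) (false ∷ y) = Sum.map (∷-mono-≼ false) (∷-mono-≼ false) (≼-total x y)
≼-total (true ∷ x)  (true ∷ y)  = Sum.map (∷-mono-≼ true) (∷-mono-≼ true) (≼-total x y)

-- Orbits of an injection on {0,1}ⁿ

module _ {A : Set} (f : A → A) where

  iter-+ : ∀ k m x → iter f (k + m) x ≡ iter f k (iter f m x)
  iter-+ zero    m x = refl
  iter-+ (suc k) m x = cong f (iter-+ k m x)

  iter-injective : Injective _≡_ _≡_ f → ∀ k → Injective _≡_ _≡_ (iter f k)
  iter-injective f-inj zero    eq = eq
  iter-injective f-inj (suc k) eq = iter-injective f-inj k (f-inj eq)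

  iter-∸-return : Injective _≡_ _≡_ f → ∀ {i j x} → i ≤ j →
                  iter f i x ≡ iter f j x → iter f (j ∸ i) x ≡ x
  iter-∸-return f-inj {i} {j} {x} i≤j eq = sym (iter-injective f-inj i (begin
    iter f i x                  ≡⟨ eq ⟩
    iter f j x                  ≡⟨ cong (λ t → iter f t x) (m+[n∸m]≡n i≤j) ⟨
    iter f (i + (j ∸ i)) x      ≡⟨ iter-+ i (j ∸ i) x ⟩
    iter f i (iter f (j ∸ i) x) ∎))
    where open ≡-Reasoning

  iter-*-periodic : ∀ {p x} → iter f p x ≡ x → ∀ c → iter f (c * p) x ≡ x
  iter-*-periodic         per zero    = refl
  iter-*-periodic {p} {x} per (suc c) = begin
    iter f (p + c * p) x       ≡⟨ iter-+ p (c * p) x ⟩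
    iter f p (iter f (c * p) x) ≡⟨ cong (iter f p) (iter-*-periodic per c) ⟩
    iter f p x                 ≡⟨ per ⟩
    x                          ∎
    where open ≡-Reasoning

  iter-%-periodic : ∀ {p x} .{{_ : NonZero p}} → iter f p x ≡ x → ∀ k → iter f k x ≡ iter f (k % p) x
  iter-%-periodic {p} {x} per k = begin
    iter f k x                           ≡⟨ cong (λ t → iter f t x) (m≡m%n+[m/n]*n k p) ⟩
    iter f (k % p + k / p * p) x         ≡⟨ iter-+ (k % p) (k / p * p) x ⟩
    iter f (k % p) (iter f (k / p * p) x) ≡⟨ cong (iter f (k % p)) (iter-*-periodic per (k / p)) ⟩
    iter f (k % p) x                     ∎
    where open ≡-Reasoning

iter-cong : ∀ {A : Set} {f g : A → A} → (∀ x → f x ≡ g x) → ∀ k x → iter f k x ≡ iter g k x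
iter-cong     f≗g zero    x = refl
iter-cong {f = f} f≗g (suc k) x = trans (cong f (iter-cong f≗g k x)) (f≗g _)

module _ {P : Pred ℕ 0ℓ} (P? : Decidable P) where

  least : ∀ {k} → P k → ∃ λ m → P m × (∀ {i} → i < m → ¬ P i)
  least {k} = go k ≤-refl
    where
    go : ∀ bound {k} → k ≤ bound → P k → ∃ λ m → P m × (∀ {i} → i < m → ¬ P i)
    go bound {k} k≤bound Pk with anyUpTo? P? k
    ... | no ∄smaller = k , Pk , λ i<k Pi → ∄smaller (_ , i<k , Pi)
    go (suc bound) k≤bound Pk | yes (i , i<k , Pi) = go bound (≤-pred (<-≤-trans i<k k≤bound)) Pi
    go zero        z≤n      Pk | yes (_ , () , _)

encode : ∀ {n} → Vec Bool n → Fin (2 ^ n)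
encode x = funToFin (Inverse.from 2↔Bool ∘ lookup x)

encode-injective : ∀ {n} → Injective _≡_ _≡_ (encode {n})
encode-injective {x = x} {y} eq = begin
  x                   ≡⟨ tabulate∘lookup x ⟨
  tabulate (lookup x) ≡⟨ tabulate-cong lookup-eq ⟩
  tabulate (lookup y) ≡⟨ tabulate∘lookup y ⟩
  y                   ∎
  where
  open ≡-Reasoning
  open Inverse 2↔Bool using (to; strictlyInverseˡ)
  decode : ∀ {n} → Fin (2 ^ n) → Fin n → Bool
  decode c i = to (finToFun c i)
  decode-encode : ∀ {n} (z : Vec Bool n) i → decode (encode z) i ≡ lookup z i
  decode-encode z i = trans (cong to (finToFun-funToFin _ i)) (strictlyInverseˡ (lookup z i))
  lookup-eq : ∀ i → lookup x i ≡ lookup y i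
  lookup-eq i = trans (sym (decode-encode x i)) (trans (cong (λ c → decode c i) eq) (decode-encode y i))

module _ {n} {f : Vec Bool n → Vec Bool n} (f-inj : Injective _≡_ _≡_ f) where

  period : ∀ x → ∃ λ p → 0 < p × p ≤ 2 ^ n × iter f p x ≡ x
  period x with i , j , i<j , eq ← pigeonhole (n<1+n (2 ^ n)) (λ i → encode (iter f (toℕ i) x)) =
    toℕ j ∸ toℕ i , m<n⇒0<n∸m i<j , ≤-trans (m∸n≤m (toℕ j) (toℕ i)) (≤-pred (toℕ<n j)) ,
    iter-∸-return f f-inj (<⇒≤ i<j) (encode-injective eq)

  minimalPeriod : ∀ x → ∃ λ h → iter f (suc h) x ≡ x × (∀ {k} → 0 < k → k ≤ h → iter f k x ≢ x)
  minimalPeriod x with p , 0<p , _ , per ← period x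
    with least (λ k → (0 <? k) ×-dec (iter f k x ≟ x)) (0<p , per)
  ... | suc h , (_ , per′) , minimal = h , per′ , λ 0<k k≤h perₖ → minimal (s≤s k≤h) (0<k , perₖ)

module _ {A : Set} {f : A → A} (f-inj : Injective _≡_ _≡_ f) {x : A} {h}
         (aperiodic : ∀ {k} → 0 < k → k ≤ h → iter f k x ≢ x) where

  iter-distinct-before-period : ∀ {i j} → i < j → j ≤ h → iter f i x ≢ iter f j x
  iter-distinct-before-period {i} {j} i<j j≤h eq =
    aperiodic (m<n⇒0<n∸m i<j) (≤-trans (m∸n≤m j i) j≤h) (iter-∸-return f f-inj (<⇒≤ i<j) eq)

  iter-injective-before-period : ∀ {i j} → i ≤ h → j ≤ h → iter f i x ≡ iter f j x → i ≡ j
  iter-injective-before-period {i} {j} i≤h j≤h eq with <-cmp i j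
  ... | tri< i<j _ _ = ⊥-elim (iter-distinct-before-period i<j j≤h eq)
  ... | tri≈ _ i≡j _ = i≡j
  ... | tri> _ _ j<i = ⊥-elim (iter-distinct-before-period j<i i≤h (sym eq))

IsOrbitMin : ∀ {n} → (Vec Bool n → Vec Bool n) → Vec Bool n → Set
IsOrbitMin f x = ∀ k → x ≼ iter f k x

-- isCycleRep only inspects the first 2ⁿ iterates; this suffices since every period can be taken ≤ 2ⁿ.
isCycleRep⇔IsOrbitMin : ∀ {n} {f : Vec Bool n → Vec Bool n} → Injective _≡_ _≡_ f →
                        ∀ x → T (isCycleRep n f x) ⇔ IsOrbitMin f x
isCycleRep⇔IsOrbitMin {n} {f} f-inj x = mk⇔ to from
  where
  to : T (isCycleRep n f x) → IsOrbitMin f x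
  to rep k with suc h , _ , p≤2ⁿ , per ← period f-inj x =
    subst (x ≼_) (sym (iter-%-periodic f per k))
      (lex≤ (applyUpTo⁻ {P = λ k → T (lexLeq x (iter f k x))} _ (2 ^ n) (all⁺ _ (upTo (2 ^ n)) rep)
                       (<-≤-trans (m%n<n k (suc h)) p≤2ⁿ)))
  from : IsOrbitMin f x → T (isCycleRep n f x)
  from min = all⁻ _ (applyUpTo⁺₁ _ (2 ^ n) λ {k} _ → _≼_.holds (min k))

isCycleRep-cong : ∀ {n} {f g : Vec Bool n → Vec Bool n} {x} → (∀ k → iter f k x ≡ iter g k x) →
                  isCycleRep n f x ≡ isCycleRep n g x
isCycleRep-cong {n} {x = x} same-orbit = cong and (map-cong (cong (lexLeq x) ∘ same-orbit) (upTo (2 ^ n)))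

infix 4 _∈[_,_]

_∈[_,_] : ℕ → ℕ → ℕ → Set
i ∈[ lo , hi ] = lo ≤ i × i ≤ hi

module _ {X : Set} (g : X → X) (F : ℕ → X) {lo hi : ℕ}
         (step : ∀ {i} → lo ≤ i → i < hi → g (F i) ≡ F (suc i)) where

  walk : ∀ d {i} → lo ≤ i → i + d ≤ hi → iter g d (F i) ≡ F (i + d)
  walk zero    {i} _    _        = cong F (sym (+-identityʳ i))
  walk (suc d) {i} lo≤i i+1+d≤hi = begin
    g (iter g d (F i)) ≡⟨ cong g (walk d lo≤i (≤-trans (+-monoʳ-≤ i (n≤1+n d)) i+1+d≤hi)) ⟩
    g (F (i + d))      ≡⟨ step (≤-trans lo≤i (m≤m+n i d)) (subst (_≤ hi) (+-suc i d) i+1+d≤hi) ⟩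
    F (suc (i + d))    ≡⟨ cong F (+-suc i d) ⟨
    F (i + suc d)      ∎
    where open ≡-Reasoning

∈[]-suc : ∀ {lo hi j} → j ∈[ lo , suc hi ] → j ∈[ lo , hi ] ⊎ j ≡ suc hi
∈[]-suc (lo≤j , j≤1+hi) with m≤n⇒m<n∨m≡n j≤1+hi
... | inj₁ j<1+hi = inj₁ (lo≤j , ≤-pred j<1+hi)
... | inj₂ j≡1+hi = inj₂ j≡1+hi

argmin : ∀ {n} (F : ℕ → Vec Bool n) {lo hi} → lo ≤ hi →
         ∃ λ i → i ∈[ lo , hi ] × (∀ {j} → j ∈[ lo , hi ] → F i ≼ F j)
argmin F {hi = zero} z≤n = 0 , (z≤n , z≤n) , λ { (_ , z≤n) → ≼-refl (F 0) }
argmin F {lo} {suc hi} lo≤1+hi with lo ≤? hi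
... | no lo≰hi = suc hi , (lo≤1+hi , ≤-refl) , λ j∈ →
      [ (λ (lo≤j , j≤hi) → ⊥-elim (lo≰hi (≤-trans lo≤j j≤hi))) , (λ { refl → ≼-refl (F (suc hi)) }) ] (∈[]-suc j∈)
... | yes lo≤hi with i , (lo≤i , i≤hi) , min ← argmin F lo≤hi with ≼-total (F i) (F (suc hi))
...   | inj₁ i≼ = i , (lo≤i , m≤n⇒m≤1+n i≤hi) , λ j∈ → [ min , (λ { refl → i≼ }) ] (∈[]-suc j∈)
...   | inj₂ ≼i = suc hi , (lo≤1+hi , ≤-refl) , λ j∈ →
      [ (λ j∈′ → ≼-trans ≼i (min j∈′)) , (λ { refl → ≼-refl (F (suc hi)) }) ] (∈[]-suc j∈)

record IsCycle {n} (g : Vec Bool n → Vec Bool n) (F : ℕ → Vec Bool n) (lo hi : ℕ) : Set where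
  field
    lo≤hi : lo ≤ hi
    step  : ∀ {i} → lo ≤ i → i < hi → g (F i) ≡ F (suc i)
    wrap  : g (F hi) ≡ F lo

  walk-to : ∀ {i j} → lo ≤ i → i ≤ j → j ≤ hi → iter g (j ∸ i) (F i) ≡ F j
  walk-to {i} {j} lo≤i i≤j j≤hi = trans
    (walk g F step (j ∸ i) lo≤i (≤-trans (≤-reflexive (m+[n∸m]≡n i≤j)) j≤hi))
    (cong F (m+[n∸m]≡n i≤j))

  stays : ∀ k {i} → i ∈[ lo , hi ] → ∃ λ j → j ∈[ lo , hi ] × iter g k (F i) ≡ F j
  stays zero    {i} i∈ = i , i∈ , refl
  stays (suc k)     i∈ with j , (lo≤j , j≤hi) , eq ← stays k i∈ with m≤n⇒m<n∨m≡n j≤hi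
  ... | inj₁ j<hi = suc j , (m≤n⇒m≤1+n lo≤j , j<hi) , trans (cong g eq) (step lo≤j j<hi)
  ... | inj₂ refl = lo , (≤-refl , lo≤hi) , trans (cong g eq) wrap

  reaches : ∀ {i j} → i ∈[ lo , hi ] → j ∈[ lo , hi ] → ∃ λ k → iter g k (F i) ≡ F j
  reaches {i} {j} (lo≤i , i≤hi) (lo≤j , j≤hi) = (j ∸ lo) + suc (hi ∸ i) , (begin
    iter g ((j ∸ lo) + suc (hi ∸ i)) (F i)      ≡⟨ iter-+ g (j ∸ lo) _ (F i) ⟩
    iter g (j ∸ lo) (g (iter g (hi ∸ i) (F i))) ≡⟨ cong (iter g (j ∸ lo) ∘ g) (walk-to lo≤i i≤hi ≤-refl) ⟩
    iter g (j ∸ lo) (g (F hi))                  ≡⟨ cong (iter g (j ∸ lo)) wrap ⟩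
    iter g (j ∸ lo) (F lo)                      ≡⟨ walk-to ≤-refl lo≤j j≤hi ⟩
    F j                                         ∎)
    where open ≡-Reasoning

  isOrbitMin⇔≼all : ∀ {i} → i ∈[ lo , hi ] → IsOrbitMin g (F i) ⇔ (∀ {j} → j ∈[ lo , hi ] → F i ≼ F j)
  isOrbitMin⇔≼all {i} i∈ = mk⇔
    (λ min {j} j∈ → let k , eq = reaches i∈ j∈ in subst (F i ≼_) eq (min k))
    (λ below k → let j , j∈ , eq = stays k i∈ in subst (F i ≼_) (sym eq) (below j∈))

  private
    minimum = argmin F lo≤hi

  argminIndex : ℕ
  argminIndex = proj₁ minimum

  argmin∈ : argminIndex ∈[ lo , hi ]
  argmin∈ = proj₁ (proj₂ minimum)

  argmin-≼ : ∀ {j} → j ∈[ lo , hi ] → F argminIndex ≼ F j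
  argmin-≼ = proj₂ (proj₂ minimum)

  isOrbitMin⇔≡argmin : ∀ {i} → i ∈[ lo , hi ] → IsOrbitMin g (F i) ⇔ F i ≡ F argminIndex
  isOrbitMin⇔≡argmin {i} i∈ = mk⇔
    (λ min → ≼-antisym (Equivalence.to (isOrbitMin⇔≼all i∈) min argmin∈) (argmin-≼ i∈))
    (λ { eq → Equivalence.from (isOrbitMin⇔≼all i∈) (λ j∈ → subst (_≼ F _) (sym eq) (argmin-≼ j∈)) })

count : ∀ {A : Set} → (A → Bool) → List A → ℕ
count p xs = length (filterᵇ p xs)

module _ {A : Set} where

  count-cong : ∀ {p q : A → Bool} → (∀ x → p x ≡ q x) → ∀ xs → count p xs ≡ count q xs
  count-cong p≗q []       = refl
  count-cong {p} {q} p≗q (x ∷ xs) with p x | q x | p≗q x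
  ... | true  | .true  | refl = cong suc (count-cong p≗q xs)
  ... | false | .false | refl = count-cong p≗q xs

  count-∨ : ∀ {p q : A → Bool} → (∀ x → T (p x) → ¬ T (q x)) → ∀ xs →
            count (λ x → p x ∨ q x) xs ≡ count p xs + count q xs
  count-∨ disjoint [] = refl
  count-∨ {p} {q} disjoint (x ∷ xs) with p x in px | q x in qx
  ... | true  | true  = ⊥-elim (disjoint x (subst T (sym px) tt) (subst T (sym qx) tt))
  ... | true  | false = cong suc (count-∨ disjoint xs)
  ... | false | true  = trans (cong suc (count-∨ disjoint xs)) (sym (+-suc _ _))
  ... | false | false = count-∨ disjoint xs

  count-false : ∀ xs → count (λ (_ : A) → false) xs ≡ 0
  count-false []       = refl
  count-false (_ ∷ xs) = count-false xs

count-allStates-suc : ∀ {m} (p : Vec Bool (suc m) → Bool) →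
  count p (allStates (suc m)) ≡ count (p ∘ (false ∷_)) (allStates m) + count (p ∘ (true ∷_)) (allStates m)
count-allStates-suc {m} p = go (allStates m)
  where
  go : ∀ xs → count p (concatMap (λ v → (false ∷ v) ∷ (true ∷ v) ∷ []) xs)
              ≡ count (p ∘ (false ∷_)) xs + count (p ∘ (true ∷_)) xs
  go [] = refl
  go (v ∷ xs) with p (false ∷ v)
  ... | true with p (true ∷ v)
  ...   | true  = cong suc (trans (cong suc (go xs)) (sym (+-suc _ _)))
  ...   | false = cong suc (go xs)
  go (v ∷ xs) | false with p (true ∷ v)
  ...   | true  = trans (cong suc (go xs)) (sym (+-suc _ _))
  ...   | false = go xs

count-≡-allStates : ∀ {m} (w : Vec Bool m) → count (λ x → does (x ≟ w)) (allStates m) ≡ 1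
count-≡-allStates []          = refl
count-≡-allStates {suc m} (false ∷ w) = trans (count-allStates-suc (λ x → does (x ≟ (false ∷ w))))
                                      (cong₂ _+_ (count-≡-allStates w) (count-false (allStates m)))
count-≡-allStates {suc m} (true ∷ w)  = trans (count-allStates-suc (λ x → does (x ≟ (true ∷ w))))
                                      (cong₂ _+_ (count-false (allStates m)) (count-≡-allStates w))

numLimitCycles-cong : ∀ {n} {f g : Vec Bool n → Vec Bool n} → (∀ x → f x ≡ g x) →
                      numLimitCycles n f ≡ numLimitCycles n g
numLimitCycles-cong {n} f≗g = count-cong (λ x → isCycleRep-cong (λ k → iter-cong f≗g k x)) (allStates n)

-- A transposition changes the number of cycles by one

swap : ∀ {n} → Vec Bool n → Vec Bool n → Vec Bool n → Vec Bool n
swap a b x = if does (x ≟ a) then b else if does (x ≟ b) then a else x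

module _ {n} {a b : Vec Bool n} where

  swap-left : swap a b a ≡ b
  swap-left rewrite dec-true (a ≟ a) refl = refl

  swap-right : a ≢ b → swap a b b ≡ a
  swap-right a≢b rewrite dec-false (b ≟ a) (a≢b ∘ sym) | dec-true (b ≟ b) refl = refl

  swap-other : ∀ {x} → x ≢ a → x ≢ b → swap a b x ≡ x
  swap-other {x} x≢a x≢b rewrite dec-false (x ≟ a) x≢a | dec-false (x ≟ b) x≢b = refl

  swap-involutive : a ≢ b → ∀ x → swap a b (swap a b x) ≡ x
  swap-involutive a≢b x = by-cases (x ≟ a) (x ≟ b)
    where
    by-cases : Dec (x ≡ a) → Dec (x ≡ b) → swap a b (swap a b x) ≡ x
    by-cases (yes refl) _        = trans (cong (swap a b) swap-left) (swap-right a≢b)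
    by-cases (no _)     (yes refl) = trans (cong (swap a b) (swap-right a≢b)) swap-left
    by-cases (no x≢a)   (no x≢b) = trans (cong (swap a b) (swap-other x≢a x≢b)) (swap-other x≢a x≢b)

  swap-injective : a ≢ b → Injective _≡_ _≡_ (swap a b)
  swap-injective a≢b {x} {y} eq =
    trans (sym (swap-involutive a≢b x)) (trans (cong (swap a b) eq) (swap-involutive a≢b y))

-- b = f^(j+1) a lies on the cycle Z = {a, f a, …, f^h a} of a. Composing with (a b) splits Z into the
-- cycles {f^0 a, …, f^j a} and {f^(j+1) a, …, f^h a}, with minima m₁ and m₂; the minimum m₀ of Z is the
-- smaller of the two, so exactly the larger one, u, becomes an additional cycle representative.
module Split {n} {f : Vec Bool n → Vec Bool n} (f-inj : Injective _≡_ _≡_ f)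
             {a b : Vec Bool n} (a≢b : a ≢ b)
             {h} (period : iter f (suc h) a ≡ a) (aperiodic : ∀ {k} → 0 < k → k ≤ h → iter f k a ≢ a)
             {j} (j<h : j < h) (a↦b : iter f (suc j) a ≡ b) where

  g : Vec Bool n → Vec Bool n
  g x = swap a b (f x)

  g-inj : Injective _≡_ _≡_ g
  g-inj = f-inj ∘ swap-injective a≢b

  F : ℕ → Vec Bool n
  F i = iter f i a

  F-injective : ∀ {i i′} → i ≤ h → i′ ≤ h → F i ≡ F i′ → i ≡ i′
  F-injective = iter-injective-before-period f-inj aperiodic

  g-step : ∀ {i} → i < h → i ≢ j → g (F i) ≡ F (suc i)
  g-step i<h i≢j = swap-other (aperiodic z<s i<h)
    (λ eq → i≢j (suc-injective (F-injective i<h j<h (trans eq (sym a↦b)))))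

  orbit : IsCycle f F 0 h
  orbit = record { lo≤hi = z≤n ; step = λ _ _ → refl ; wrap = period }

  cycle₁ : IsCycle g F 0 j
  cycle₁ = record
    { lo≤hi = z≤n
    ; step  = λ _ i<j → g-step (<-trans i<j j<h) (<⇒≢ i<j)
    ; wrap  = trans (cong (swap a b) a↦b) (swap-right a≢b)
    }

  cycle₂ : IsCycle g F (suc j) h
  cycle₂ = record
    { lo≤hi = j<h
    ; step  = λ j<i i<h → g-step i<h (>⇒≢ j<i)
    ; wrap  = trans (cong (swap a b) period) (trans (swap-left {a = a}) (sym a↦b))
    }

  open IsCycle orbit  using () renaming (argminIndex to i₀; argmin∈ to i₀∈; argmin-≼ to i₀-≼)
  open IsCycle cycle₁ using () renaming (argminIndex to i₁; argmin∈ to i₁∈; argmin-≼ to i₁-≼)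
  open IsCycle cycle₂ using () renaming (argminIndex to i₂; argmin∈ to i₂∈; argmin-≼ to i₂-≼)

  m₀ m₁ m₂ : Vec Bool n
  m₀ = F i₀
  m₁ = F i₁
  m₂ = F i₂

  i₁<i₂ : i₁ < i₂
  i₁<i₂ = <-≤-trans (s≤s (proj₂ i₁∈)) (proj₁ i₂∈)

  i₁≤h : i₁ ≤ h
  i₁≤h = ≤-trans (proj₂ i₁∈) (<⇒≤ j<h)

  m₁≢m₂ : m₁ ≢ m₂
  m₁≢m₂ eq = <⇒≢ i₁<i₂ (F-injective i₁≤h (proj₂ i₂∈) eq)

  f-rep⇔ : ∀ {i} → i ≤ h → T (isCycleRep n f (F i)) ⇔ F i ≡ m₀
  f-rep⇔ {i} i≤h = ⇔.trans (isCycleRep⇔IsOrbitMin f-inj (F i)) (IsCycle.isOrbitMin⇔≡argmin orbit (z≤n , i≤h))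

  g-min⇔ : ∀ {i} → i ≤ h → IsOrbitMin g (F i) ⇔ (F i ≡ m₁ ⊎ F i ≡ m₂)
  g-min⇔ {i} i≤h with i ≤? j
  ... | yes i≤j = ⇔.trans (IsCycle.isOrbitMin⇔≡argmin cycle₁ (z≤n , i≤j)) (mk⇔ inj₁ [ id , ⊥-elim ∘ ≢m₂ ])
    where
    ≢m₂ : F i ≢ m₂
    ≢m₂ eq = <⇒≢ (<-≤-trans (s≤s i≤j) (proj₁ i₂∈)) (F-injective i≤h (proj₂ i₂∈) eq)
  ... | no  i≰j = ⇔.trans (IsCycle.isOrbitMin⇔≡argmin cycle₂ (≰⇒> i≰j , i≤h)) (mk⇔ inj₂ [ ⊥-elim ∘ ≢m₁ , id ])
    where
    ≢m₁ : F i ≢ m₁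
    ≢m₁ eq = <⇒≢ (<-≤-trans (s≤s (proj₂ i₁∈)) (≰⇒> i≰j)) (sym (F-injective i≤h i₁≤h eq))

  m₀≡m₁⊎m₀≡m₂ : m₀ ≡ m₁ ⊎ m₀ ≡ m₂
  m₀≡m₁⊎m₀≡m₂ with i₀ ≤? j
  ... | yes i₀≤j = inj₁ (≼-antisym (i₀-≼ (z≤n , i₁≤h)) (i₁-≼ (z≤n , i₀≤j)))
  ... | no  i₀≰j = inj₂ (≼-antisym (i₀-≼ (z≤n , proj₂ i₂∈)) (i₂-≼ (≰⇒> i₀≰j , proj₂ i₀∈)))

  InOrbit : Vec Bool n → Set
  InOrbit x = ∃ λ i → i ≤ h × F i ≡ x

  inOrbit? : ∀ x → Dec (InOrbit x)
  inOrbit? x = map′ (λ (i , i<1+h , eq) → i , ≤-pred i<1+h , eq) (λ (i , i≤h , eq) → i , s≤s i≤h , eq)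
                    (anyUpTo? (λ i → F i ≟ x) (suc h))

  inOrbit-preimage : ∀ {x} → InOrbit (f x) → InOrbit x
  inOrbit-preimage (zero  , _     , a≡fx) = h , ≤-refl , f-inj (trans period a≡fx)
  inOrbit-preimage (suc i , 1+i≤h , eq)   = i , ≤-trans (n≤1+n i) 1+i≤h , f-inj eq

  g-agrees-off-orbit : ∀ {x} → ¬ InOrbit x → ∀ k → iter g k x ≡ iter f k x
  g-agrees-off-orbit {x} ∉ zero    = refl
  g-agrees-off-orbit {x} ∉ (suc k) = trans (cong g (g-agrees-off-orbit ∉ k)) (swap-other
    (λ eq → ∉ (reaches-orbit (suc k) (0 , z≤n , sym eq)))
    (λ eq → ∉ (reaches-orbit (suc k) (suc j , j<h , trans a↦b (sym eq)))))
    where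
    reaches-orbit : ∀ k → InOrbit (iter f k x) → InOrbit x
    reaches-orbit zero    = id
    reaches-orbit (suc k) = reaches-orbit k ∘ inOrbit-preimage

  module _ {u} (u-other : (m₀ ≡ m₁ × u ≡ m₂) ⊎ (m₀ ≡ m₂ × u ≡ m₁)) where

    u∈ : InOrbit u
    u∈ = [ (λ (_ , u≡m₂) → i₂ , proj₂ i₂∈ , sym u≡m₂)
         , (λ (_ , u≡m₁) → i₁ , i₁≤h , sym u≡m₁) ] u-other

    m₀≢u : m₀ ≢ u
    m₀≢u = [ (λ (e₀ , e) eq → m₁≢m₂ (trans (sym e₀) (trans eq e)))
           , (λ (e₀ , e) eq → m₁≢m₂ (sym (trans (sym e₀) (trans eq e)))) ] u-other

    minima : ∀ {x} → (x ≡ m₁ ⊎ x ≡ m₂) ⇔ (x ≡ m₀ ⊎ x ≡ u)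
    minima = [ (λ (e₀ , e) → mk⇔ (Sum.map (λ eq → trans eq (sym e₀)) (λ eq → trans eq (sym e)))
                                  (Sum.map (λ eq → trans eq e₀) (λ eq → trans eq e)))
             , (λ (e₀ , e) → mk⇔ [ (λ eq → inj₂ (trans eq (sym e))) , (λ eq → inj₁ (trans eq (sym e₀))) ]
                                  [ (λ eq → inj₂ (trans eq e₀)) , (λ eq → inj₁ (trans eq e)) ])
             ] u-other

    isCycleRep-g : ∀ x → isCycleRep n g x ≡ isCycleRep n f x ∨ does (x ≟ u)
    isCycleRep-g x with inOrbit? x
    ... | yes (i , i≤h , refl) = T-injective (⇔.trans g-side (⇔.sym f-side))
      where
      g-side : T (isCycleRep n g (F i)) ⇔ (F i ≡ m₀ ⊎ F i ≡ u)
      g-side = ⇔.trans (isCycleRep⇔IsOrbitMin g-inj (F i)) (⇔.trans (g-min⇔ i≤h) minima)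
      f-side : T (isCycleRep n f (F i) ∨ does (F i ≟ u)) ⇔ (F i ≡ m₀ ⊎ F i ≡ u)
      f-side = ⇔.trans T-∨ (f-rep⇔ i≤h ⊎-⇔ T-does (F i ≟ u))
    ... | no ∉ = begin
      isCycleRep n g x                     ≡⟨ isCycleRep-cong (g-agrees-off-orbit ∉) ⟩
      isCycleRep n f x                     ≡⟨ ∨-identityʳ _ ⟨
      isCycleRep n f x ∨ false             ≡⟨ cong (isCycleRep n f x ∨_) (dec-false (x ≟ u) (λ { refl → ∉ u∈ })) ⟨
      isCycleRep n f x ∨ does (x ≟ u)      ∎
      where open ≡-Reasoning

    f-rep-≢u : ∀ x → T (isCycleRep n f x) → ¬ T (does (x ≟ u))
    f-rep-≢u x rep x≟u with refl ← Equivalence.to (T-does (x ≟ u)) x≟u with i , i≤h , refl ← u∈ =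
      m₀≢u (sym (Equivalence.to (f-rep⇔ i≤h) rep))

    numLimitCycles-g : numLimitCycles n g ≡ suc (numLimitCycles n f)
    numLimitCycles-g = begin
      count (isCycleRep n g) (allStates n)
        ≡⟨ count-cong isCycleRep-g (allStates n) ⟩
      count (λ x → isCycleRep n f x ∨ does (x ≟ u)) (allStates n)
        ≡⟨ count-∨ f-rep-≢u (allStates n) ⟩
      numLimitCycles n f + count (λ x → does (x ≟ u)) (allStates n)
        ≡⟨ cong (numLimitCycles n f +_) (count-≡-allStates u) ⟩
      numLimitCycles n f + 1
        ≡⟨ +-comm (numLimitCycles n f) 1 ⟩
      suc (numLimitCycles n f) ∎
      where open ≡-Reasoning

  numLimitCycles-split : numLimitCycles n g ≡ suc (numLimitCycles n f)
  numLimitCycles-split with m₀≡m₁⊎m₀≡m₂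
  ... | inj₁ m₀≡m₁ = numLimitCycles-g (inj₁ (m₀≡m₁ , refl))
  ... | inj₂ m₀≡m₂ = numLimitCycles-g (inj₂ (m₀≡m₂ , refl))

module _ {n} {f : Vec Bool n → Vec Bool n} (f-inj : Injective _≡_ _≡_ f) {a b : Vec Bool n} (a≢b : a ≢ b) where

  numLimitCycles-swap-split : (∃ λ k → iter f k a ≡ b) → numLimitCycles n (swap a b ∘ f) ≡ suc (numLimitCycles n f)
  numLimitCycles-swap-split (k , a↦b) with h , period , aperiodic ← minimalPeriod f-inj a =
    within-period (k % suc h) (m%n<n k (suc h)) (trans (sym (iter-%-periodic f period k)) a↦b)
    where
    within-period : ∀ r → r < suc h → iter f r a ≡ b → numLimitCycles n (swap a b ∘ f) ≡ suc (numLimitCycles n f)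
    within-period zero    _         a≡b = ⊥-elim (a≢b a≡b)
    within-period (suc j) (s≤s j<h) a↦b = Split.numLimitCycles-split f-inj a≢b period aperiodic j<h a↦b

parity : ℕ → Bool
parity zero    = false
parity (suc n) = not (parity n)

parity-2* : ∀ k → parity (2 * k) ≡ false
parity-2* zero    = refl
parity-2* (suc k) = trans (cong parity (*-suc 2 k)) (trans (not-involutive _) (parity-2* k))

parity≡false⇒2∣ : ∀ k → parity k ≡ false → 2 ∣ k
parity≡false⇒2∣ zero          _ = divides 0 refl
parity≡false⇒2∣ (suc (suc k)) p = ∣m∣n⇒∣m+n ∣-refl (parity≡false⇒2∣ k (trans (sym (not-involutive _)) p))

parity-count-∷ : ∀ {A : Set} (p : A → Bool) x xs → parity (count p (x ∷ xs)) ≡ p x xor parity (count p xs)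
parity-count-∷ p x xs with p x
... | true  = refl
... | false = refl

numLimitCycles-swap-parity : ∀ {n} {f : Vec Bool n → Vec Bool n} → Injective _≡_ _≡_ f → ∀ {a b} → a ≢ b →
  parity (numLimitCycles n (swap a b ∘ f)) ≡ not (parity (numLimitCycles n f))
numLimitCycles-swap-parity {n} {f} f-inj {a} {b} a≢b with h , period , aperiodic ← minimalPeriod f-inj a
  with anyUpTo? (λ k → iter f k a ≟ b) (suc h)
... | yes (k , _ , a↦b) = cong parity (numLimitCycles-swap-split f-inj a≢b (k , a↦b))
... | no  unreachable  = begin
  parity (numLimitCycles n g)             ≡⟨ not-involutive _ ⟨
  not (parity (suc (numLimitCycles n g))) ≡⟨ cong (not ∘ parity) merge ⟨
  not (parity (numLimitCycles n f))       ∎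
  where
  open ≡-Reasoning
  g : Vec Bool n → Vec Bool n
  g = swap a b ∘ f
  step : ∀ {i} → 0 ≤ i → i < h → g (iter f i a) ≡ iter f (suc i) a
  step {i} _ i<h = swap-other (aperiodic z<s i<h) (λ eq → unreachable (suc i , s≤s i<h , eq))
  g-reaches-b : iter g (suc h) a ≡ b
  g-reaches-b = trans (cong g (walk g (λ i → iter f i a) step h z≤n ≤-refl))
                      (trans (cong (swap a b) period) (swap-left {a = a}))
  -- In g the points a and b lie on one cycle, and (a b) ∘ g = f splits it.
  merge : numLimitCycles n f ≡ suc (numLimitCycles n g)
  merge = trans (numLimitCycles-cong (λ x → sym (swap-involutive a≢b (f x))))
                (numLimitCycles-swap-split (f-inj ∘ swap-injective a≢b) a≢b (suc h , g-reaches-b))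

-- The circular shift

onTail : ∀ {m} → (Vec Bool m → Vec Bool m) → Vec Bool (suc m) → Vec Bool (suc m)
onTail h (b ∷ y) = b ∷ h y

module _ {m} {h : Vec Bool m → Vec Bool m} (h-inj : Injective _≡_ _≡_ h) where

  onTail-injective : Injective _≡_ _≡_ (onTail h)
  onTail-injective {b ∷ y} {c ∷ z} eq = cong₂ _∷_ (∷-injectiveˡ eq) (h-inj (∷-injectiveʳ eq))

  iter-onTail : ∀ k b y → iter (onTail h) k (b ∷ y) ≡ b ∷ iter h k y
  iter-onTail zero    b y = refl
  iter-onTail (suc k) b y = cong (onTail h) (iter-onTail k b y)

  isCycleRep-onTail : ∀ b y → isCycleRep (suc m) (onTail h) (b ∷ y) ≡ isCycleRep m h y
  isCycleRep-onTail b y = T-injective (⇔.trans (isCycleRep⇔IsOrbitMin onTail-injective (b ∷ y))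
    (⇔.trans (mk⇔ to from) (⇔.sym (isCycleRep⇔IsOrbitMin h-inj y))))
    where
    to : IsOrbitMin (onTail h) (b ∷ y) → IsOrbitMin h y
    to min k = ∷-cancel-≼ b (subst (b ∷ y ≼_) (iter-onTail k b y) (min k))
    from : IsOrbitMin h y → IsOrbitMin (onTail h) (b ∷ y)
    from min k = subst (b ∷ y ≼_) (sym (iter-onTail k b y)) (∷-mono-≼ b (min k))

  numLimitCycles-onTail : numLimitCycles (suc m) (onTail h) ≡ 2 * numLimitCycles m h
  numLimitCycles-onTail = begin
    numLimitCycles (suc m) (onTail h)
      ≡⟨ count-allStates-suc (isCycleRep (suc m) (onTail h)) ⟩
    count (isCycleRep (suc m) (onTail h) ∘ (false ∷_)) (allStates m)
      + count (isCycleRep (suc m) (onTail h) ∘ (true ∷_)) (allStates m)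
      ≡⟨ cong₂ _+_ (count-cong (isCycleRep-onTail false) (allStates m))
                   (count-cong (isCycleRep-onTail true) (allStates m)) ⟩
    numLimitCycles m h + numLimitCycles m h
      ≡⟨ cong (numLimitCycles m h +_) (+-identityʳ (numLimitCycles m h)) ⟨
    2 * numLimitCycles m h ∎
    where open ≡-Reasoning

swapHeadIf : ∀ {m} → Bool → Vec Bool (suc (suc m)) → Vec Bool (suc (suc m))
swapHeadIf false x           = x
swapHeadIf true  (c ∷ d ∷ w) = d ∷ c ∷ w

adjacentSwap : ∀ {m} → Vec Bool m → Vec Bool (suc (suc m)) → Vec Bool (suc (suc m))
adjacentSwap z = swap (false ∷ true ∷ z) (true ∷ false ∷ z)

adjacentSwap-spec : ∀ {m} (z : Vec Bool m) c d w →
                    adjacentSwap z (c ∷ d ∷ w) ≡ swapHeadIf (does (z ≟ w)) (c ∷ d ∷ w)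
adjacentSwap-spec z c d w with z ≟ w
adjacentSwap-spec z false false w | yes refl = swap-other {a = false ∷ true ∷ z} {true ∷ false ∷ z} (λ ()) (λ ())
adjacentSwap-spec z false true  w | yes refl = swap-left {a = false ∷ true ∷ z} {true ∷ false ∷ z}
adjacentSwap-spec z true  false w | yes refl = swap-right {a = false ∷ true ∷ z} {true ∷ false ∷ z} (λ ())
adjacentSwap-spec z true  true  w | yes refl = swap-other {a = false ∷ true ∷ z} {true ∷ false ∷ z} (λ ()) (λ ())
... | no z≢w = swap-other (z≢w ∘ sym ∘ ∷-injectiveʳ ∘ ∷-injectiveʳ)
                          (z≢w ∘ sym ∘ ∷-injectiveʳ ∘ ∷-injectiveʳ)

swapAll : ∀ {m} → List (Vec Bool m) → Vec Bool (suc (suc m)) → Vec Bool (suc (suc m))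
swapAll zs x = foldr adjacentSwap x zs

swapAll-injective : ∀ {m} (zs : List (Vec Bool m)) → Injective _≡_ _≡_ (swapAll zs)
swapAll-injective []       = id
swapAll-injective (z ∷ zs) = swapAll-injective zs ∘ swap-injective (λ ())

swapHeadIf-xor : ∀ {m} p q (x : Vec Bool (suc (suc m))) → swapHeadIf p (swapHeadIf q x) ≡ swapHeadIf (p xor q) x
swapHeadIf-xor false q     x           = refl
swapHeadIf-xor true  false x           = refl
swapHeadIf-xor true  true  (c ∷ d ∷ w) = refl

swapAll-spec : ∀ {m} (zs : List (Vec Bool m)) c d w →
  swapAll zs (c ∷ d ∷ w) ≡ swapHeadIf (parity (count (λ z → does (z ≟ w)) zs)) (c ∷ d ∷ w)
swapAll-spec []       c d w = refl
swapAll-spec (z ∷ zs) c d w = begin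
  adjacentSwap z (swapAll zs (c ∷ d ∷ w))               ≡⟨ cong (adjacentSwap z) (swapAll-spec zs c d w) ⟩
  adjacentSwap z (swapHeadIf q (c ∷ d ∷ w))             ≡⟨ adjacentSwap-swapHeadIf q ⟩
  swapHeadIf (does (z ≟ w)) (swapHeadIf q (c ∷ d ∷ w))  ≡⟨ swapHeadIf-xor (does (z ≟ w)) q _ ⟩
  swapHeadIf (does (z ≟ w) xor q) (c ∷ d ∷ w)           ≡⟨ cong (λ p → swapHeadIf p (c ∷ d ∷ w)) parity-count ⟨
  swapHeadIf (parity (count ≟w (z ∷ zs))) (c ∷ d ∷ w)   ∎
  where
  open ≡-Reasoning
  ≟w : Vec Bool _ → Bool
  ≟w v = does (v ≟ w)
  q = parity (count ≟w zs)
  parity-count : parity (count ≟w (z ∷ zs)) ≡ does (z ≟ w) xor q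
  parity-count = parity-count-∷ ≟w z zs
  adjacentSwap-swapHeadIf : ∀ q → adjacentSwap z (swapHeadIf q (c ∷ d ∷ w))
                                  ≡ swapHeadIf (does (z ≟ w)) (swapHeadIf q (c ∷ d ∷ w))
  adjacentSwap-swapHeadIf false = adjacentSwap-spec z c d w
  adjacentSwap-swapHeadIf true  = adjacentSwap-spec z d c w

swapAll-allStates : ∀ {m} c d (w : Vec Bool m) → swapAll (allStates m) (c ∷ d ∷ w) ≡ d ∷ c ∷ w
swapAll-allStates c d w rewrite swapAll-spec (allStates _) c d w | count-≡-allStates w = refl

parity-swapAll : ∀ {m} {h : Vec Bool (2 + m) → Vec Bool (2 + m)} → Injective _≡_ _≡_ h → ∀ zs →
  parity (numLimitCycles (2 + m) (swapAll zs ∘ h)) ≡ parity (length zs) xor parity (numLimitCycles (2 + m) h)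
parity-swapAll h-inj []       = refl
parity-swapAll h-inj (z ∷ zs) = trans
  (numLimitCycles-swap-parity (h-inj ∘ swapAll-injective zs) (λ ()))
  (trans (cong not (parity-swapAll h-inj zs)) (not-distribˡ-xor (parity (length zs)) _))

shift-decomposition : ∀ m x → shift (suc (suc m)) x ≡ swapAll (allStates m) (onTail (shift (suc m)) x)
shift-decomposition m (b ∷ c ∷ z) = sym (swapAll-allStates b (last (c ∷ z)) (init (c ∷ z)))

shift-injective : ∀ n → Injective _≡_ _≡_ (shift n)
shift-injective zero          {[]}     {[]}     _  = refl
shift-injective (suc zero)    {x ∷ []} {y ∷ []} eq = eq
shift-injective (suc (suc m)) {x}      {y}      eq = onTail-injective (shift-injective (suc m))
  (swapAll-injective (allStates m) (trans (sym (shift-decomposition m x)) (trans eq (shift-decomposition m y))))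

length-allStates : ∀ n → length (allStates n) ≡ 2 ^ n
length-allStates zero    = refl
length-allStates (suc n) = trans (length-pairs (allStates n)) (cong (2 *_) (length-allStates n))
  where
  length-pairs : ∀ xs → length (concatMap (λ v → (false ∷ v) ∷ (true ∷ v) ∷ []) xs) ≡ 2 * length xs
  length-pairs []       = refl
  length-pairs (_ ∷ xs) = trans (cong (suc ∘ suc) (length-pairs xs)) (sym (*-suc 2 (length xs)))

lemma6 : (n : ℕ) → 3 ≤ n → 2 ∣ numLimitCycles n (shift n)
lemma6 (suc (suc (suc m))) (s≤s (s≤s (s≤s z≤n))) = parity≡false⇒2∣ _ (begin
  parity (numLimitCycles (3 + m) (shift (3 + m)))
    ≡⟨ cong parity (numLimitCycles-cong (shift-decomposition (suc m))) ⟩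
  parity (numLimitCycles (3 + m) (swapAll (allStates (suc m)) ∘ onTail (shift (2 + m))))
    ≡⟨ parity-swapAll (onTail-injective (shift-injective (2 + m))) (allStates (suc m)) ⟩
  parity (length (allStates (suc m))) xor parity (numLimitCycles (3 + m) (onTail (shift (2 + m))))
    ≡⟨ cong₂ (λ l c → parity l xor parity c) (length-allStates (suc m)) (numLimitCycles-onTail (shift-injective (2 + m))) ⟩
  parity (2 * 2 ^ m) xor parity (2 * numLimitCycles (2 + m) (shift (2 + m)))
    ≡⟨ cong₂ _xor_ (parity-2* (2 ^ m)) (parity-2* (numLimitCycles (2 + m) (shift (2 + m)))) ⟩
  false ∎)
  where open ≡-Reasoning
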